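{- Let $n\ge0$ and $m\ge2$ be integers, and let $x=(n+1)F_m+\lfloor n\phi\rfloor F_{m+1}$. Then $\mathrm{sh}_F(x)=(n+1)F_{m+1}+\lfloor n\phi\rfloor F_{m+2}$.
   Context: $F_i$ are the Fibonacci numbers ($F_0=0,F_1=1,F_{m+1}=F_m+F_{m-1}$), $\phi=(1+\sqrt5)/2$. Every positive integer $x$ has a unique Zeckendorf representation $x=\sum_{i\in S}F_i$ with all indices $i\ge2$ and no two consecutive; the Zeckendorf shift is $\mathrm{sh}_F(x)=\sum_{i\in S}F_{i+1}$, with $\mathrm{sh}_F(0)=0$. -}

module Defs where

open import Data.Nat using (ℕ; zero; suc; _+_; _*_; _∸_; _^_; _≤_; _<_)
open import Data.List using (List; map)
open import Data.Nat.ListAction using (sum)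
open import Relation.Binary.PropositionalEquality using (_≡_)
open import Data.List.Relation.Unary.All using (All)
open import Data.List.Relation.Unary.Linked using (Linked)
open import Data.Product using (_×_)

F : ℕ → ℕ
F zero = zero
F (suc zero) = suc zero
F (suc (suc m)) = F (suc m) + F m

-- An index set S is represented as a list of indices in strictly decreasing
-- order with consecutive entries differing by at least 2 (no two consecutive
-- indices), all indices ≥ 2.
ZeckIndices : List ℕ → Set
ZeckIndices S = All (λ i → 2 ≤ i) S × Linked (λ i j → 2 + j ≤ i) S

ZeckRep : List ℕ → ℕ → Set
ZeckRep S x = ZeckIndices S × sum (map F S) ≡ x

-- Σ_{i∈S} F_{i+1}: the value of sh_F on the number represented by S.
shiftSum : List ℕ → ℕ
shiftSum S = sum (map (λ i → F (suc i)) S)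

-- k = ⌊ n φ ⌋ with φ = (1+√5)/2, characterised as the floor is defined:
-- k ≤ nφ < k+1.  Since nφ = (n + √(5n²))/2, we have
--   k ≤ nφ    ⇔ 2k - n ≤ √(5n²)     ⇔ (2k ∸ n)² ≤ 5n²
--   nφ < k+1  ⇔ √(5n²) < 2(k+1) - n ⇔ n < 2(k+1) and 5n² < (2(k+1) ∸ n)².
IsFloorNPhi : ℕ → ℕ → Set
IsFloorNPhi n k =
  ((2 * k ∸ n) ^ 2 ≤ 5 * n ^ 2)
  × (n < 2 * suc k × 5 * n ^ 2 < (2 * suc k ∸ n) ^ 2)

-- For a Zeckendorf set S with value x and shift y = sh_F x, Binet's formula gives
-- y − φx = Σ_{i∈S} ψ^i with ψ = −1/φ.  Over sets of non-consecutive indices ≥ 2 this sum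
-- lies strictly between −φ⁻² (all odd indices) and φ⁻¹ (all even indices), an interval of
-- length 1, so x determines y.  For x = (n+1)F_m + kF_{m+1} with k = ⌊nφ⌋ the candidate
-- y = (n+1)F_{m+1} + kF_{m+2} has y − φx = ψ^m (n + 1 − k/φ) with n + 1 − k/φ ∈ (0, φ),
-- which lies in the same interval when m ≥ 2.
-- Reals are avoided by scaling with F_M for large M: y − φx becomes y F_M − x F_{M+1},
-- ψ^i becomes (−1)^i F_{M−i}, and the sign of y − φx for naturals x, y is the eventual sign
-- of y F_M − x F_{M+1}, which Euclid's algorithm on (x, y) computes.

module Submission where

open import Defs
open import Data.Empty using (⊥-elim)
open import Data.Integer using (ℤ; +_; 0ℤ; -_; _-_; +≤+; +<+)
  renaming (_+_ to _+ℤ_; _*_ to _*ℤ_; _≤_ to _≤ℤ_; _<_ to _<ℤ_)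
import Data.Integer.Properties as ℤ
open import Data.Integer.Tactic.RingSolver using (solve-∀)
open import Data.List using (List; []; _∷_; map)
open import Data.List.Relation.Unary.All using (All; []; _∷_)
open import Data.List.Relation.Unary.Linked using (Linked; []; [-]; _∷_)
open import Data.Nat using (ℕ; zero; suc; _+_; _*_; _∸_; _^_; _≤_; _<_; _≤′_; z≤n; s≤s; ≤′-refl; ≤′-step)
open import Data.Nat.Induction using (<-wellFounded)
open import Data.Nat.ListAction using (sum)
open import Data.Nat.Properties
  using (≤-refl; ≤-trans; ≤-antisym; ≤-pred; <⇒≤; <⇒≱; ≤-<-trans; ≤⇒≤′; ≤-<-connex; <-≤-connex;
         n≮0; n<1+n; n≤1+n; m≤m+n; m≤n+m; m<m+n; m≤n⇒∃[o]m+o≡n;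
         +-comm; +-mono-≤; +-monoˡ-≤; +-monoˡ-<; +-mono-≤-<; +-cancelˡ-<; +-cancelʳ-≤; +-cancelʳ-<;
         *-mono-≤; *-monoˡ-≤; *-monoʳ-≤; *-mono-<; *-monoʳ-<; *-cancelˡ-≤; *-cancelˡ-<;
         m+[n∸m]≡n; m+n∸m≡n; m∸n+n≡m; m<n⇒0<n∸m; ∸-monoˡ-≤; ∸-monoʳ-≤; module ≤-Reasoning)
open import Data.Nat.Tactic.RingSolver using () renaming (solve-∀ to ℕ-solve-∀)
open import Data.Product using (_×_; _,_; ∃; ∃-syntax; proj₁; proj₂)
open import Data.Sum using (inj₁; inj₂; [_,_]′)
open import Function using (id; _∘_)
open import Induction.WellFounded using (Acc; acc)
open import Relation.Binary.PropositionalEquality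
  using (_≡_; refl; sym; trans; cong; cong₂; subst; subst₂; module ≡-Reasoning)

F-pos : ∀ {n} → 0 < n → 0 < F n
F-pos {suc zero} _ = s≤s z≤n
F-pos {suc (suc n)} _ = ≤-trans (F-pos {suc n} (s≤s z≤n)) (m≤m+n (F (suc n)) (F n))

F-mono-≤ : ∀ {m n} → m ≤ n → F m ≤ F n
F-mono-≤ m≤n = go (≤⇒≤′ m≤n)
  where
  go : ∀ {m n} → m ≤′ n → F m ≤ F n
  go ≤′-refl = ≤-refl
  go {n = suc n} (≤′-step m≤n) = ≤-trans (go m≤n) (step n)
    where
    step : ∀ n → F n ≤ F (suc n)
    step zero = z≤n
    step (suc n) = m≤m+n (F (suc n)) (F n)

n<F[2+n] : ∀ n → n < F (2 + n)
n<F[2+n] zero = s≤s z≤n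
n<F[2+n] (suc n) = subst (_≤ F (3 + n)) (+-comm (suc n) 1)
  (+-mono-≤ (n<F[2+n] n) (F-pos {suc n} (s≤s z≤n)))

F-∸-rec : ∀ a {m} → 2 + a ≤ m → F (m ∸ a) ≡ F (m ∸ suc a) + F (m ∸ (2 + a))
F-∸-rec zero {suc (suc m)} _ = refl
F-∸-rec zero {suc zero} (s≤s ())
F-∸-rec (suc a) {suc m} (s≤s le) = F-∸-rec a le

F-∸-monoʳ-≥ : ∀ m {a b} → a ≤ b → F (m ∸ b) ≤ F (m ∸ a)
F-∸-monoʳ-≥ m a≤b = F-mono-≤ (∸-monoʳ-≤ m a≤b)

F-∸-sub : ∀ a {M} → 2 + a ≤ M → + F (M ∸ (2 + a)) ≡ + F (M ∸ a) - + F (M ∸ suc a)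
F-∸-sub a {M} le rewrite F-∸-rec a le | ℤ.pos-+ (F (M ∸ suc a)) (F (M ∸ (2 + a))) =
  sym (ring (+ F (M ∸ suc a)) (+ F (M ∸ (2 + a))))
  where
  ring : ∀ b c → (b +ℤ c) - b ≡ c
  ring = solve-∀

-- Existence of Zeckendorf representations

-- In Linked _≫_ (t ∷ S) the head t is a virtual index: it bounds the indices of S by t ∸ 2.
_≫_ : ℕ → ℕ → Set
i ≫ j = 2 + j ≤ i

≫-raise : ∀ {a b S} → a ≤ b → Linked _≫_ (a ∷ S) → Linked _≫_ (b ∷ S)
≫-raise a≤b [-] = [-]
≫-raise a≤b (a≫i ∷ l) = ≤-trans a≫i a≤b ∷ l

zeckendorf-below : ∀ j x → x < F j → ∃[ S ] ZeckRep S x × Linked _≫_ (suc j ∷ S)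
zeckendorf-below (suc zero) zero _ = [] , (([] , []) , refl) , [-]
zeckendorf-below (suc zero) (suc x) (s≤s ())
zeckendorf-below (suc (suc zero)) zero _ = [] , (([] , []) , refl) , [-]
zeckendorf-below (suc (suc zero)) (suc x) (s≤s ())
zeckendorf-below (suc (suc (suc j))) x x<F =
  [ fits (zeckendorf-below (suc (suc j)) x) , take-top (zeckendorf-below (suc j) (x ∸ F (2 + j))) ]′
  (<-≤-connex x (F (2 + j)))
  where
  Below : ℕ → ℕ → Set
  Below t y = ∃[ S ] ZeckRep S y × Linked _≫_ (t ∷ S)

  fits : (x < F (2 + j) → Below (3 + j) x) → x < F (2 + j) → Below (4 + j) x
  fits below x<F′ =
    let S , rep , top = below x<F′
    in S , rep , ≫-raise (m≤n+m (3 + j) 1) top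

  take-top : (x ∸ F (2 + j) < F (1 + j) → Below (2 + j) (x ∸ F (2 + j))) → F (2 + j) ≤ x → Below (4 + j) x
  take-top below F≤x =
    let x≡F+x′ = sym (m+[n∸m]≡n F≤x)
        S , ((2≤S , _) , sum≡x′) , top = below (+-cancelˡ-< (F (2 + j)) _ _ (subst (_< F (3 + j)) x≡F+x′ x<F))
    in (2 + j ∷ S) , ((s≤s (s≤s z≤n) ∷ 2≤S , top) , trans (cong (λ s → F (2 + j) + s) sum≡x′) (sym x≡F+x′))
       , ≤-refl ∷ top

zeckendorf-exists : ∀ x → ∃[ S ] ZeckRep S x
zeckendorf-exists x with S , rep , _ ← zeckendorf-below (2 + x) x (n<F[2+n] x) = S , rep

Eventually : (ℕ → Set) → Set
Eventually P = ∃[ M₀ ] (∀ {M} → M₀ ≤ M → P M)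

module _ {P Q : ℕ → Set} where

  eventually-map : (∀ {M} → P M → Q M) → Eventually P → Eventually Q
  eventually-map f (M₀ , p) = M₀ , f ∘ p

  eventually-zip : Eventually P → Eventually Q → Eventually (λ M → P M × Q M)
  eventually-zip (M₁ , p) (M₂ , q) =
    M₁ + M₂ , λ le → p (≤-trans (m≤m+n M₁ M₂) le) , q (≤-trans (m≤n+m M₂ M₁) le)

eventually-offset : ∀ {P : ℕ → Set} K → Eventually (λ j → P (K + j)) → Eventually P
eventually-offset {P} K (J , p) = K + J , λ {M} K+J≤M →
  subst P (m+[n∸m]≡n (≤-trans (m≤m+n K J) K+J≤M))
    (p (subst (_≤ M ∸ K) (m+n∸m≡n K J) (∸-monoˡ-≤ K K+J≤M)))

-- The defect y F_M − x F_{M+1}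

i-j<0⇒i<j : ∀ {i j} → i - j <ℤ 0ℤ → i <ℤ j
i-j<0⇒i<j {i} {j} p = subst₂ _<ℤ_ (ring i j) (ℤ.+-identityˡ j) (ℤ.+-monoˡ-< j p)
  where
  ring : ∀ i j → (i - j) +ℤ j ≡ i
  ring = solve-∀

0<j-i⇒i<j : ∀ {i j} → 0ℤ <ℤ j - i → i <ℤ j
0<j-i⇒i<j {i} {j} p = subst₂ _<ℤ_ (ℤ.+-identityʳ i) (ring i j) (ℤ.+-monoʳ-< i p)
  where
  ring : ∀ i j → i +ℤ (j - i) ≡ j
  ring = solve-∀

0<i+j⇒-j<i : ∀ {i j} → 0ℤ <ℤ i +ℤ j → - j <ℤ i
0<i+j⇒-j<i {i} {j} p = subst₂ _<ℤ_ (ℤ.+-identityʳ (- j)) (ring i j) (ℤ.+-monoʳ-< (- j) p)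
  where
  ring : ∀ i j → - j +ℤ (i +ℤ j) ≡ i
  ring = solve-∀

-- defect x y M ≈ (y − φx) F_M, as F_{M+1} ≈ φ F_M.
defect : ℕ → ℕ → ℕ → ℤ
defect x y M = + y *ℤ + F M - + x *ℤ + F (suc M)

defect-zero : ∀ M → defect 0 0 M ≡ 0ℤ
defect-zero M = ring (+ F M) (+ F (suc M))
  where
  ring : ∀ a b → + 0 *ℤ a - + 0 *ℤ b ≡ 0ℤ
  ring = solve-∀

defect-+ : ∀ x₁ x₂ y₁ y₂ M → defect (x₁ + x₂) (y₁ + y₂) M ≡ defect x₁ y₁ M +ℤ defect x₂ y₂ M
defect-+ x₁ x₂ y₁ y₂ M
  rewrite ℤ.pos-+ x₁ x₂ | ℤ.pos-+ y₁ y₂ = ring (+ x₁) (+ x₂) (+ y₁) (+ y₂) (+ F M) (+ F (suc M))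
  where
  ring : ∀ x₁ x₂ y₁ y₂ f f′ →
         (y₁ +ℤ y₂) *ℤ f - (x₁ +ℤ x₂) *ℤ f′ ≡ (y₁ *ℤ f - x₁ *ℤ f′) +ℤ (y₂ *ℤ f - x₂ *ℤ f′)
  ring = solve-∀

defect-cons : ∀ i S M → defect (sum (map F (i ∷ S))) (shiftSum (i ∷ S)) M
                        ≡ defect (F i) (F (suc i)) M +ℤ defect (sum (map F S)) (shiftSum S) M
defect-cons i S M = defect-+ (F i) (sum (map F S)) (F (suc i)) (shiftSum S) M

defect-suc : ∀ x y M → defect (suc x) y M ≡ defect x y M - + F (suc M)
defect-suc x y M rewrite ℤ.pos-+ 1 x = ring (+ x) (+ y *ℤ + F M) (+ F (suc M))
  where
  ring : ∀ x a f → a - (+ 1 +ℤ x) *ℤ f ≡ (a - x *ℤ f) - f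
  ring = solve-∀

defect-euclid : ∀ x r M → defect x (x + r) (suc M) ≡ - defect r x M
defect-euclid x r M rewrite ℤ.pos-+ x r | ℤ.pos-+ (F (suc M)) (F M) =
  ring (+ x) (+ r) (+ F (suc M)) (+ F M)
  where
  ring : ∀ x r f₁ f₀ → (x +ℤ r) *ℤ f₁ - x *ℤ (f₁ +ℤ f₀) ≡ - (x *ℤ f₀ - r *ℤ f₁)
  ring = solve-∀

-- For X = F this is d'Ocagne's identity: defect (F i) (F (1 + i)) (i + j) = (−1)^i F_j.
module _ (X : ℕ → ℕ) (X-rec : ∀ m → X (2 + m) ≡ X (1 + m) + X m) where

  defect-step : ∀ m M → defect (X (1 + m)) (X (2 + m)) (1 + M) ≡ - defect (X m) (X (1 + m)) M
  defect-step m M rewrite X-rec m | ℤ.pos-+ (X (1 + m)) (X m) | ℤ.pos-+ (F (1 + M)) (F M) =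
    ring (+ X (1 + m)) (+ X m) (+ F (1 + M)) (+ F M)
    where
    ring : ∀ a b f f′ → (a +ℤ b) *ℤ f - a *ℤ (f +ℤ f′) ≡ - (a *ℤ f′ - b *ℤ f)
    ring = solve-∀

  defect-step₂ : ∀ m M → defect (X (2 + m)) (X (3 + m)) (2 + M) ≡ defect (X m) (X (1 + m)) M
  defect-step₂ m M = begin
    defect (X (2 + m)) (X (3 + m)) (2 + M)   ≡⟨ defect-step (1 + m) (1 + M) ⟩
    - defect (X (1 + m)) (X (2 + m)) (1 + M) ≡⟨ cong -_ (defect-step m M) ⟩
    - - defect (X m) (X (1 + m)) M           ≡⟨ ℤ.neg-involutive _ ⟩
    defect (X m) (X (1 + m)) M               ∎
    where open ≡-Reasoning

  defect-step-invariant : (P : ℤ → Set) → (∀ {z} → P z → P (- z)) →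
                          ∀ m j → P (defect (X 0) (X 1) j) → P (defect (X m) (X (1 + m)) (m + j))
  defect-step-invariant P neg zero j p = p
  defect-step-invariant P neg (suc m) j p =
    subst P (sym (defect-step m (m + j))) (neg (defect-step-invariant P neg m j p))

defect-F : ∀ j → defect (F 0) (F 1) j ≡ + F j
defect-F j = ring (+ F j) (+ F (suc j))
  where
  ring : ∀ a b → + 1 *ℤ a - + 0 *ℤ b ≡ a
  ring = solve-∀

defect-F-bounds : ∀ {i M} → i ≤ M →
                  - + F (M ∸ i) ≤ℤ defect (F i) (F (suc i)) M × defect (F i) (F (suc i)) M ≤ℤ + F (M ∸ i)
defect-F-bounds {i} i≤M with j , refl ← m≤n⇒∃[o]m+o≡n i≤M rewrite m+n∸m≡n i j =
  defect-step-invariant F (λ _ → refl) Bounded flip i j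
    (subst Bounded (sym (defect-F j)) (ℤ.neg-≤-pos , ℤ.≤-refl))
  where
  Bounded : ℤ → Set
  Bounded z = - + F j ≤ℤ z × z ≤ℤ + F j
  flip : ∀ {z} → Bounded z → Bounded (- z)
  flip (lower , upper) = ℤ.neg-mono-≤ upper , subst (- _ ≤ℤ_) (ℤ.neg-involutive _) (ℤ.neg-mono-≤ lower)

defect-F-two : ∀ {M} → 2 ≤ M → defect (F 2) (F 3) M ≡ + F (M ∸ 2)
defect-F-two {suc zero} (s≤s ())
defect-F-two {suc (suc j)} _ = trans (defect-step₂ F (λ _ → refl) 0 j) (defect-F j)

-- Zeckendorf sums pin down the shift

-- The scaled form of −φ⁻² < y − φx < φ⁻¹.
ShiftBounds : ℕ → ℕ → ℕ → Set
ShiftBounds x y M = - + F (M ∸ 2) <ℤ defect x y M × defect x y M <ℤ + F (M ∸ 1)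

-- defect (sum S) (shiftSum S) M = Σ_{i∈S} (−1)^i F_{M−i}.  The extreme S are all even, resp. all odd,
-- indices below 2 + N, and those sums telescope: F_{M−2} + F_{M−4} + ⋯ + F_{M−2r} = F_{M−1} − F_{M−1−2r}.
upper-gap : ∀ {N S} → All (2 ≤_) S → Linked _≫_ (2 + N ∷ S) → ∀ {M} → suc N ≤ M →
            + F (M ∸ suc N) ≤ℤ + F (M ∸ 1) - defect (sum (map F S)) (shiftSum S) M
upper-gap {N} {[]} [] _ {M} _ = begin
  + F (M ∸ suc N)             ≤⟨ +≤+ (F-∸-monoʳ-≥ M (s≤s z≤n)) ⟩
  + F (M ∸ 1)                 ≡⟨ sym (ℤ.+-identityʳ _) ⟩
  + F (M ∸ 1) - 0ℤ            ≡⟨ cong (λ d → + F (M ∸ 1) - d) (sym (defect-zero M)) ⟩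
  + F (M ∸ 1) - defect 0 0 M  ∎
  where open ℤ.≤-Reasoning
upper-gap {S = suc zero ∷ _} (s≤s () ∷ _)
upper-gap {N} {suc (suc i) ∷ S} (_ ∷ 2≤S) (s≤s (s≤s i≤N) ∷ top) {M} N<M = begin
  + F (M ∸ suc N)                           ≤⟨ +≤+ (F-∸-monoʳ-≥ M (s≤s i≤N)) ⟩
  + F (M ∸ (3 + i))                         ≡⟨ F-∸-sub (suc i) (≤-trans (s≤s i≤N) N<M) ⟩
  + F (M ∸ suc i) - + F (M ∸ (2 + i))       ≤⟨ ℤ.+-mono-≤ (upper-gap 2≤S top (<⇒≤ i≤M))
                                                          (ℤ.neg-mono-≤ (proj₂ (defect-F-bounds i≤M))) ⟩
  (+ F (M ∸ 1) - δ) - d                     ≡⟨ ring (+ F (M ∸ 1)) δ d ⟩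
  + F (M ∸ 1) - (d +ℤ δ)                    ≡⟨ cong (λ e → + F (M ∸ 1) - e) (sym (defect-cons (2 + i) S M)) ⟩
  + F (M ∸ 1) - defect (sum (map F (2 + i ∷ S))) (shiftSum (2 + i ∷ S)) M ∎
  where
  open ℤ.≤-Reasoning
  i≤M : 2 + i ≤ M
  i≤M = ≤-trans i≤N (<⇒≤ N<M)
  δ d : ℤ
  δ = defect (sum (map F S)) (shiftSum S) M
  d = defect (F (2 + i)) (F (3 + i)) M
  ring : ∀ a b c → (a - b) - c ≡ a - (c +ℤ b)
  ring = solve-∀

lower-gap : ∀ {N S} → 1 ≤ N → All (2 ≤_) S → Linked _≫_ (2 + N ∷ S) → ∀ {M} → suc N ≤ M →
            + F (M ∸ suc N) ≤ℤ defect (sum (map F S)) (shiftSum S) M +ℤ + F (M ∸ 2)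
lower-gap {N} {[]} 1≤N [] _ {M} _ = begin
  + F (M ∸ suc N)               ≤⟨ +≤+ (F-∸-monoʳ-≥ M (s≤s 1≤N)) ⟩
  + F (M ∸ 2)                   ≡⟨ sym (ℤ.+-identityˡ _) ⟩
  0ℤ +ℤ + F (M ∸ 2)             ≡⟨ cong (_+ℤ + F (M ∸ 2)) (sym (defect-zero M)) ⟩
  defect 0 0 M +ℤ + F (M ∸ 2)   ∎
  where open ℤ.≤-Reasoning
lower-gap {S = suc zero ∷ _} _ (s≤s () ∷ _)
-- Here |defect| ≤ F_{M−2} is too weak; the sign of the index-2 term is needed.
lower-gap {N} {2 ∷ []} 1≤N _ _ {M} N<M = begin
  + F (M ∸ suc N)                                     ≤⟨ +≤+ (F-∸-monoʳ-≥ M (s≤s 1≤N)) ⟩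
  + F (M ∸ 2)                                         ≤⟨ ℤ.i≤j⇒i≤k+j (+ F (M ∸ 2)) ℤ.≤-refl ⟩
  + F (M ∸ 2) +ℤ + F (M ∸ 2)                          ≡⟨ cong (_+ℤ + F (M ∸ 2)) (sym two) ⟩
  defect (F 2 + 0) (F 3 + 0) M +ℤ + F (M ∸ 2)         ∎
  where
  open ℤ.≤-Reasoning
  two : defect (F 2 + 0) (F 3 + 0) M ≡ + F (M ∸ 2)
  two = begin-equality
    defect (F 2 + 0) (F 3 + 0) M             ≡⟨ defect-cons 2 [] M ⟩
    defect (F 2) (F 3) M +ℤ defect 0 0 M
      ≡⟨ cong₂ _+ℤ_ (defect-F-two (≤-trans (s≤s 1≤N) N<M)) (defect-zero M) ⟩
    + F (M ∸ 2) +ℤ 0ℤ                        ≡⟨ ℤ.+-identityʳ _ ⟩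
    + F (M ∸ 2)                              ∎
lower-gap {S = 2 ∷ zero ∷ _} _ (_ ∷ () ∷ _)
lower-gap {S = 2 ∷ suc _ ∷ _} _ _ (_ ∷ (s≤s (s≤s ()) ∷ _))
lower-gap {N} {suc (suc (suc i)) ∷ S} _ (_ ∷ 2≤S) (s≤s (s≤s i≤N) ∷ top) {M} N<M = begin
  + F (M ∸ suc N)                           ≤⟨ +≤+ (F-∸-monoʳ-≥ M (s≤s i≤N)) ⟩
  + F (M ∸ (4 + i))                         ≡⟨ F-∸-sub (2 + i) (≤-trans (s≤s i≤N) N<M) ⟩
  + F (M ∸ (2 + i)) - + F (M ∸ (3 + i))     ≤⟨ ℤ.+-mono-≤ (lower-gap (s≤s z≤n) 2≤S top (<⇒≤ i≤M))
                                                          (proj₁ (defect-F-bounds i≤M)) ⟩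
  (δ +ℤ + F (M ∸ 2)) +ℤ d                   ≡⟨ ring δ (+ F (M ∸ 2)) d ⟩
  (d +ℤ δ) +ℤ + F (M ∸ 2)                   ≡⟨ cong (_+ℤ + F (M ∸ 2)) (sym (defect-cons (3 + i) S M)) ⟩
  defect (sum (map F (3 + i ∷ S))) (shiftSum (3 + i ∷ S)) M +ℤ + F (M ∸ 2) ∎
  where
  open ℤ.≤-Reasoning
  i≤M : 3 + i ≤ M
  i≤M = ≤-trans i≤N (<⇒≤ N<M)
  δ d : ℤ
  δ = defect (sum (map F S)) (shiftSum S) M
  d = defect (F (3 + i)) (F (4 + i)) M
  ring : ∀ a b c → (a +ℤ b) +ℤ c ≡ (c +ℤ a) +ℤ b
  ring = solve-∀

zeckendorf-top : ∀ {S} → ZeckIndices S → ∃[ N ] 1 ≤ N × Linked _≫_ (2 + N ∷ S)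
zeckendorf-top {[]} _ = 1 , ≤-refl , [-]
zeckendorf-top {i ∷ _} (2≤i ∷ _ , linked) = i , ≤-trans (s≤s z≤n) 2≤i , ≤-refl ∷ linked

zeckendorf-shiftBounds : ∀ {S} → ZeckIndices S → Eventually (ShiftBounds (sum (map F S)) (shiftSum S))
zeckendorf-shiftBounds {S} indices@(2≤S , _) with N , 1≤N , top ← zeckendorf-top indices =
  2 + N , λ {M} N<M →
    let 0<F = +<+ (F-pos (m<n⇒0<n∸m N<M))
    in  0<i+j⇒-j<i (ℤ.<-≤-trans 0<F (lower-gap 1≤N 2≤S top (<⇒≤ N<M)))
      , 0<j-i⇒i<j (ℤ.<-≤-trans 0<F (upper-gap 2≤S top (<⇒≤ N<M)))

-- The bounds leave a window of width F_{M−1} + F_{M−2} = F_M for y F_M.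
shiftBounds-≤ : ∀ {x y y′ M} → 2 ≤ M → ShiftBounds x y M → ShiftBounds x y′ M → y ≤ y′
shiftBounds-≤ {M = suc zero} (s≤s ())
shiftBounds-≤ {x} {y} {y′} {suc (suc j)} _ (_ , y-upper) (y′-lower , _) =
  ≤-pred (ℤ.drop‿+<+ (ℤ.*-cancelʳ-<-nonNeg (+ F (2 + j)) (begin-strict
    + y *ℤ + F (2 + j)                           ≡⟨ ring₁ (+ y *ℤ + F (2 + j)) X (+ F j) ⟩
    (+ y *ℤ + F (2 + j) - X - + F j) +ℤ (X +ℤ + F j)
      <⟨ ℤ.+-monoˡ-< (X +ℤ + F j) (ℤ.+-mono-< y-upper y′-lower) ⟩
    (+ F (1 + j) +ℤ (+ y′ *ℤ + F (2 + j) - X)) +ℤ (X +ℤ + F j)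
      ≡⟨ ring₂ (+ F (1 + j)) (+ F j) (+ y′) X ⟩
    (+ 1 +ℤ + y′) *ℤ (+ F (1 + j) +ℤ + F j)
      ≡⟨ cong ((+ 1 +ℤ + y′) *ℤ_) (sym (ℤ.pos-+ (F (1 + j)) (F j))) ⟩
    + suc y′ *ℤ + F (2 + j)                      ∎)))
  where
  open ℤ.≤-Reasoning
  X : ℤ
  X = + x *ℤ + F (3 + j)
  ring₁ : ∀ a b c → a ≡ (a - b - c) +ℤ (b +ℤ c)
  ring₁ = solve-∀
  ring₂ : ∀ f₁ f₀ y′ X → (f₁ +ℤ (y′ *ℤ (f₁ +ℤ f₀) - X)) +ℤ (X +ℤ f₀) ≡ (+ 1 +ℤ y′) *ℤ (f₁ +ℤ f₀)
  ring₂ = solve-∀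

shiftSum-determined : ∀ {S x y} → ZeckIndices S → sum (map F S) ≡ x → Eventually (ShiftBounds x y) →
                      shiftSum S ≡ y
shiftSum-determined {S} {y = y} indices refl bounds
  with M , always ← eventually-zip (2 , id) (eventually-zip (zeckendorf-shiftBounds indices) bounds)
  with 2≤M , zeck , target ← always ≤-refl
  = ≤-antisym (shiftBounds-≤ {x} {shiftSum S} {y} 2≤M zeck target) (shiftBounds-≤ {x} {y} 2≤M target zeck)
  where
  x : ℕ
  x = sum (map F S)

-- The eventual sign of the defect

y≤x⇒defect<0 : ∀ {x y} → y ≤ x → 0 < x → ∀ {M} → 2 ≤ M → defect x y M <ℤ 0ℤ
y≤x⇒defect<0 _ _ {suc zero} (s≤s ())
y≤x⇒defect<0 {suc x} {y} y≤x _ {suc (suc j)} _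
  rewrite sym (ℤ.pos-* y (F (2 + j))) | sym (ℤ.pos-* (suc x) (F (3 + j))) =
  subst (+ (y * F (2 + j)) - + (suc x * F (3 + j)) <ℤ_) (ℤ.+-inverseʳ (+ (suc x * F (3 + j))))
    (ℤ.+-monoˡ-< (- + (suc x * F (3 + j))) (+<+ yF<xF))
  where
  yF<xF : y * F (2 + j) < suc x * F (3 + j)
  yF<xF = ≤-<-trans (*-monoˡ-≤ (F (2 + j)) y≤x)
                    (*-monoʳ-< (suc x) (m<m+n (F (2 + j)) (F-pos {suc j} (s≤s z≤n))))

private
  split-left : ∀ x r → x * x + x * (x + r) ≡ (x * x + x * r) + x * x
  split-left = ℕ-solve-∀
  split-right : ∀ x r → (x + r) * (x + r) ≡ (x * x + x * r) + (r * r + r * x)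
  split-right = ℕ-solve-∀

ratio>φ-step : ∀ x r → x * x + x * (x + r) < (x + r) * (x + r) → x * x < r * r + r * x
ratio>φ-step x r h = +-cancelˡ-< (x * x + x * r) _ _ (subst₂ _<_ (split-left x r) (split-right x r) h)

ratio<φ-step : ∀ x r → (x + r) * (x + r) < x * x + x * (x + r) → r * r + r * x < x * x
ratio<φ-step x r h = +-cancelˡ-< (x * x + x * r) _ _ (subst₂ _<_ (split-right x r) (split-left x r) h)

-- x² + xy < y² says y > φx.  With y = x + r, defect-euclid turns the comparison of y with φx into
-- that of x with φr, so the recursion is Euclid's algorithm on (x, y).
mutual
  defect-eventually-pos : ∀ x y → Acc _<_ y → x * x + x * y < y * y → Eventually (λ M → 0ℤ <ℤ defect x y M)
  defect-eventually-pos x y (acc smaller) h with <-≤-connex x y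
  ... | inj₂ y≤x = ⊥-elim (<⇒≱ h (≤-trans (*-mono-≤ y≤x y≤x) (m≤m+n (x * x) (x * y))))
  ... | inj₁ x<y with r , refl ← m≤n⇒∃[o]m+o≡n (<⇒≤ x<y) =
    eventually-offset 1
      (eventually-map (λ {M} d<0 → subst (0ℤ <ℤ_) (sym (defect-euclid x r M)) (ℤ.neg-mono-< d<0))
        (defect-eventually-neg r x (smaller x<y) (ratio>φ-step x r h)))

  defect-eventually-neg : ∀ x y → Acc _<_ y → y * y < x * x + x * y → Eventually (λ M → defect x y M <ℤ 0ℤ)
  defect-eventually-neg zero y _ h = ⊥-elim (n≮0 h)
  defect-eventually-neg x@(suc _) y (acc smaller) h with <-≤-connex x y
  ... | inj₂ y≤x = 2 , y≤x⇒defect<0 y≤x (s≤s z≤n)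
  ... | inj₁ x<y with r , refl ← m≤n⇒∃[o]m+o≡n (<⇒≤ x<y) =
    eventually-offset 1
      (eventually-map (λ {M} 0<d → subst (_<ℤ 0ℤ) (sym (defect-euclid x r M)) (ℤ.neg-mono-< 0<d))
        (defect-eventually-pos r x (smaller x<y) (ratio<φ-step x r h)))

-- The floor of nφ

-- With u = 2K − n: u² − 5n² = 4(K² − Kn − n²).  Hence k ≤ nφ becomes k² ≤ kn + n² and
-- nφ < K becomes Kn + n² < K².
floor-identity : ∀ u n K → u + n ≡ 2 * K → u ^ 2 + 4 * (K * n + n * n) ≡ 4 * (K * K) + 5 * n ^ 2
floor-identity u n K u+n≡2K = begin
  u ^ 2 + 4 * (K * n + n * n)             ≡⟨ expand-K u n K ⟩
  u ^ 2 + 2 * (2 * K) * n + 4 * (n * n)   ≡⟨ cong (λ t → u ^ 2 + 2 * t * n + 4 * (n * n)) (sym u+n≡2K) ⟩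
  u ^ 2 + 2 * (u + n) * n + 4 * (n * n)   ≡⟨ regroup u n ⟩
  (u + n) * (u + n) + 5 * n ^ 2           ≡⟨ cong (λ t → t * t + 5 * n ^ 2) u+n≡2K ⟩
  (2 * K) * (2 * K) + 5 * n ^ 2           ≡⟨ square-2K K n ⟩
  4 * (K * K) + 5 * n ^ 2                 ∎
  where
  open ≡-Reasoning
  expand-K : ∀ u n c → u * (u * 1) + 4 * (c * n + n * n) ≡ u * (u * 1) + 2 * (2 * c) * n + 4 * (n * n)
  expand-K = ℕ-solve-∀
  regroup : ∀ u n → u * (u * 1) + 2 * (u + n) * n + 4 * (n * n) ≡ (u + n) * (u + n) + 5 * (n * (n * 1))
  regroup = ℕ-solve-∀
  square-2K : ∀ c n → (2 * c) * (2 * c) + 5 * (n * (n * 1)) ≡ 4 * (c * c) + 5 * (n * (n * 1))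
  square-2K = ℕ-solve-∀

floor-lower : ∀ {n k} → IsFloorNPhi n k → k * k ≤ k * n + n * n
floor-lower {n} {k} (u²≤5n² , _) with ≤-<-connex n (2 * k)
... | inj₁ n≤2k = *-cancelˡ-≤ 4 (+-cancelʳ-≤ (5 * n ^ 2) _ _ (begin
  4 * (k * k) + 5 * n ^ 2                    ≡⟨ sym (floor-identity (2 * k ∸ n) n k (m∸n+n≡m n≤2k)) ⟩
  (2 * k ∸ n) ^ 2 + 4 * (k * n + n * n)      ≤⟨ +-monoˡ-≤ (4 * (k * n + n * n)) u²≤5n² ⟩
  5 * n ^ 2 + 4 * (k * n + n * n)            ≡⟨ +-comm (5 * n ^ 2) _ ⟩
  4 * (k * n + n * n) + 5 * n ^ 2            ∎))
  where open ≤-Reasoning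
... | inj₂ 2k<n = ≤-trans (*-monoʳ-≤ k (≤-trans (m≤m+n k (k + 0)) (<⇒≤ 2k<n))) (m≤m+n (k * n) (n * n))

floor-upper : ∀ {n k} → IsFloorNPhi n k → suc k * n + n * n < suc k * suc k
floor-upper {n} {k} (_ , n<2K , 5n²<v²) = *-cancelˡ-< 4 _ _ (+-cancelʳ-< (5 * n ^ 2) _ _ (begin-strict
  4 * (K * n + n * n) + 5 * n ^ 2            ≡⟨ +-comm _ (5 * n ^ 2) ⟩
  5 * n ^ 2 + 4 * (K * n + n * n)            <⟨ +-monoˡ-< (4 * (K * n + n * n)) 5n²<v² ⟩
  (2 * K ∸ n) ^ 2 + 4 * (K * n + n * n)      ≡⟨ floor-identity (2 * K ∸ n) n K (m∸n+n≡m (<⇒≤ n<2K)) ⟩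
  4 * (K * K) + 5 * n ^ 2                    ∎))
  where
  open ≤-Reasoning
  K : ℕ
  K = suc k

-- The claimed shift

-- The theorem's x is G n k m and the claimed shift is G n k (1 + m).
G : ℕ → ℕ → ℕ → ℕ
G n k m = suc n * F m + k * F (suc m)

G-rec : ∀ n k m → G n k (2 + m) ≡ G n k (1 + m) + G n k m
G-rec n k m = ring (suc n) k (F (suc m)) (F m)
  where
  ring : ∀ c k a b → c * (a + b) + k * ((a + b) + a) ≡ (c * a + k * (a + b)) + (c * b + k * a)
  ring = ℕ-solve-∀

G-initial : ∀ n k j → defect (G n k 0) (G n k 1) j ≡ defect k (suc n + k) j
G-initial n k j = cong₂ (λ x y → defect x y j) (G₀ n k) (G₁ n k)
  where
  G₀ : ∀ n k → (1 + n) * 0 + k * 1 ≡ k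
  G₀ = ℕ-solve-∀
  G₁ : ∀ n k → (1 + n) * 1 + k * 1 ≡ 1 + n + k
  G₁ = ℕ-solve-∀

-- defect k (n + 1 + k) j ≈ (n + 1 − k/φ) F_j and F_{j+1} ≈ φ F_j: the bounds are k < (n + 1)φ and nφ < k + 1.
target-defect-bounds : ∀ {n k} → IsFloorNPhi n k →
  Eventually (λ j → 0ℤ <ℤ defect k (suc n + k) j × defect k (suc n + k) j <ℤ + F (suc j))
target-defect-bounds {n} {k} floor = eventually-zip
  (defect-eventually-pos k (suc n + k) (<-wellFounded _) pos-condition)
  (eventually-map (λ {j} d<0 → i-j<0⇒i<j (subst (_<ℤ 0ℤ) (defect-suc k (suc n + k) j) d<0))
    (defect-eventually-neg (suc k) (suc n + k) (<-wellFounded _) neg-condition))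
  where
  pos-condition : k * k + k * (suc n + k) < (suc n + k) * (suc n + k)
  pos-condition = subst₂ _<_ (lhs n k) (rhs n k) (+-monoˡ-< (k * suc n + k * k) (begin-strict
    k * k                   ≤⟨ floor-lower floor ⟩
    k * n + n * n           <⟨ +-mono-≤-< (*-monoʳ-≤ k (n≤1+n n)) (*-mono-< (n<1+n n) (n<1+n n)) ⟩
    k * suc n + suc n * suc n ∎))
    where
    open ≤-Reasoning
    lhs : ∀ n k → k * k + (k * (1 + n) + k * k) ≡ k * k + k * (1 + n + k)
    lhs = ℕ-solve-∀
    rhs : ∀ n k → (k * (1 + n) + (1 + n) * (1 + n)) + (k * (1 + n) + k * k) ≡ (1 + n + k) * (1 + n + k)
    rhs = ℕ-solve-∀
  neg-condition : (suc n + k) * (suc n + k) < suc k * suc k + suc k * (suc n + k)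
  neg-condition = subst₂ _<_ (lhs n k) (rhs n k) (+-monoˡ-< (suc k * n + suc k * suc k) (floor-upper floor))
    where
    lhs : ∀ n k → ((1 + k) * n + n * n) + ((1 + k) * n + (1 + k) * (1 + k)) ≡ (1 + n + k) * (1 + n + k)
    lhs = ℕ-solve-∀
    rhs : ∀ n k → (1 + k) * (1 + k) + ((1 + k) * n + (1 + k) * (1 + k))
                  ≡ (1 + k) * (1 + k) + (1 + k) * (1 + n + k)
    rhs = ℕ-solve-∀

target-shiftBounds : ∀ {n m k} → 2 ≤ m → IsFloorNPhi n k → Eventually (ShiftBounds (G n k m) (G n k (suc m)))
target-shiftBounds {m = suc zero} (s≤s ())
target-shiftBounds {n} {suc (suc m)} {k} _ floor =
  eventually-offset (2 + m) (eventually-map bounds (target-defect-bounds floor))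
  where
  e : ℕ → ℤ
  e = defect k (suc n + k)
  bounds : ∀ {j} → 0ℤ <ℤ e j × e j <ℤ + F (suc j) → ShiftBounds (G n k (2 + m)) (G n k (3 + m)) (2 + m + j)
  bounds {j} (0<e , e<F) = lower m , ℤ.<-≤-trans (proj₂ (symmetric m)) (+≤+ (F-mono-≤ (s≤s (m≤n+m j m))))
    where
    Bounded : ℤ → Set
    Bounded z = - + F (suc j) <ℤ z × z <ℤ + F (suc j)
    flip : ∀ {z} → Bounded z → Bounded (- z)
    flip (lower , upper) = ℤ.neg-mono-< upper , subst (- _ <ℤ_) (ℤ.neg-involutive _) (ℤ.neg-mono-< lower)
    -F<0 : - + F (suc j) <ℤ 0ℤ
    -F<0 = ℤ.neg-mono-< (+<+ (F-pos {suc j} (s≤s z≤n)))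
    symmetric : ∀ m → Bounded (defect (G n k (2 + m)) (G n k (3 + m)) (2 + m + j))
    symmetric m = defect-step-invariant (G n k) (G-rec n k) Bounded flip (2 + m) j
      (subst Bounded (sym (G-initial n k j)) (ℤ.<-trans -F<0 0<e , e<F))
    lower : ∀ m → - + F (m + j) <ℤ defect (G n k (2 + m)) (G n k (3 + m)) (2 + m + j)
    lower zero = ℤ.≤-<-trans ℤ.neg-≤-pos
      (subst (0ℤ <ℤ_) (sym (trans (defect-step₂ (G n k) (G-rec n k) 0 j) (G-initial n k j))) 0<e)
    lower (suc m) = ℤ.≤-<-trans (ℤ.neg-mono-≤ (+≤+ (F-mono-≤ (s≤s (m≤n+m j m))))) (proj₁ (symmetric (suc m)))

lemma7 : (n m k : ℕ) → 2 ≤ m → IsFloorNPhi n k →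
         let x = suc n * F m + k * F (suc m) in
         (∃ λ (S : List ℕ) → ZeckRep S x)
         × ((S : List ℕ) → ZeckRep S x →
              shiftSum S ≡ suc n * F (suc m) + k * F (suc (suc m)))
lemma7 n m k 2≤m floor =
  zeckendorf-exists (G n k m) ,
  λ S (indices , sum≡x) → shiftSum-determined indices sum≡x (target-shiftBounds 2≤m floor)
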